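{- For every integer $n\ge0$, $a_{n,n}=b_{n,n}$.
   Context: For nonnegative integers $p,q$, $a_{p,q}$ denotes the number of ways to partition a set consisting of $p$ marked points on a line and $q$ marked points on a parallel line into pairs, joining the two points of each pair by a straight segment, such that no two segments have a common point (in particular, no endpoint lies on another segment). In particular $a_{0,0}=1$. For integers $k,n\ge1$, consider $k$ marked points on a line and $n$ marked points on a parallel line. A configuration is a choice of segments, each joining two neighbouring points on the same line, such that no point is an endpoint of two chosen segments. Its objects are the chosen segments together with the points that are not endpoints of chosen segments. $b_{k,n}$ is the number of configurations in which the numbers of objects on the two lines are equal. By convention $b_{0,0}=1$. -}

module Defs where

open import Data.Nat using (ℕ; zero; suc; _+_; _∸_; _*_; _≡ᵇ_; _<ᵇ_; _≤ᵇ_)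
open import Data.Bool using (Bool; true; false; _∧_; _∨_; not)
open import Data.Fin using (Fin; toℕ; splitAt)
open import Data.Sum using (_⊎_; inj₁; inj₂)
open import Data.Product using (_×_; _,_)
open import Data.Maybe using (Maybe; just; nothing)
open import Data.List using (List; []; _∷_; [_]; map; concatMap; filterᵇ; length; allFin; cartesianProduct)
open import Data.Bool.ListAction using (and)
open import Data.Vec using (Vec; lookup; toList) renaming ([] to []ᵥ; _∷_ to _∷ᵥ_)

allVecs : {A : Set} → (m : ℕ) → List A → List (Vec A m)
allVecs zero    xs = [ []ᵥ ]
allVecs (suc m) xs = concatMap (λ x → map (x ∷ᵥ_) (allVecs m xs)) xs

forallFin : (m : ℕ) → (Fin m → Bool) → Bool
forallFin m P = and (map P (allFin m))

eqFin : {m : ℕ} → Fin m → Fin m → Bool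
eqFin a b = toℕ a ≡ᵇ toℕ b

-- Model: the p marked points on the first line are at positions
-- 0,1,…,p-1 (from left to right) of that line, the q marked points on the
-- second (parallel) line at positions 0,…,q-1.  The set of all p+q marked
-- points is Fin (p + q); 'splitAt p' tells which line a point is on and its
-- position there (inj₁ = first line, inj₂ = second line).

Pos : ℕ → ℕ → Set
Pos p q = Fin p ⊎ Fin q

between : ℕ → ℕ → ℕ → Bool
between i j k = ((i ≤ᵇ k) ∧ (k ≤ᵇ j)) ∨ ((j ≤ᵇ k) ∧ (k ≤ᵇ i))

-- A segment joining two points of the same line is the interval between
-- them on that line; a segment joining points of different lines meets the
-- lines (hence the marked points) only at its two endpoints.
onSeg : {p q : ℕ} → Pos p q → Pos p q → Pos p q → Bool
onSeg (inj₁ i) (inj₁ j) (inj₁ k) = between (toℕ i) (toℕ j) (toℕ k)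
onSeg (inj₂ i) (inj₂ j) (inj₂ k) = between (toℕ i) (toℕ j) (toℕ k)
onSeg _        _        _        = false

asCross : {p q : ℕ} → Pos p q → Pos p q → Maybe (ℕ × ℕ)
asCross (inj₁ i) (inj₂ j) = just (toℕ i , toℕ j)
asCross (inj₂ j) (inj₁ i) = just (toℕ i , toℕ j)
asCross _        _        = nothing

-- Two segments joining the two lines cross at a point strictly between the
-- lines iff their endpoints appear in opposite orders on the two lines.
crossPairs : Maybe (ℕ × ℕ) → Maybe (ℕ × ℕ) → Bool
crossPairs (just (i , j)) (just (i' , j')) = ((i <ᵇ i') ∧ (j' <ᵇ j)) ∨ ((i' <ᵇ i) ∧ (j <ᵇ j'))
crossPairs _ _ = false

-- A candidate pairing of the p+q points: the vector f sends each point to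
-- its partner.  It is a partition into pairs iff f is a fixed-point-free
-- involution.  The segments {x, f x} have pairwise no common point iff
--  (1) no marked point other than x, f x lies on the segment {x, f x}, and
--  (2) no two segments joining the two lines cross between the lines.
-- (Two distinct segments with a common point either share a marked point,
-- which then is a marked point lying on the other segment, or are two
-- inter-line segments crossing strictly between the lines.)
validPairing : (p q : ℕ) → Vec (Fin (p + q)) (p + q) → Bool
validPairing p q f =
  forallFin m (λ x → eqFin (partner (partner x)) x) ∧
  forallFin m (λ x → not (eqFin (partner x) x)) ∧
  forallFin m (λ x → forallFin m (λ z →
     not (not (eqFin z x) ∧ not (eqFin z (partner x)) ∧
          onSeg (pos x) (pos (partner x)) (pos z)))) ∧
  forallFin m (λ x → forallFin m (λ y →
     not (crossPairs (asCross (pos x) (pos (partner x)))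
                     (asCross (pos y) (pos (partner y))))))
  where
    m = p + q
    partner : Fin m → Fin m
    partner x = lookup f x
    pos : Fin m → Pos p q
    pos = splitAt p

a : ℕ → ℕ → ℕ
a p q = length (filterᵇ (validPairing p q) (allVecs (p + q) (allFin (p + q))))

-- A configuration on a line with m marked points (positions 0,…,m-1) is a
-- vector c of m ∸ 1 Booleans; entry i says whether the segment joining the
-- neighbouring points i and i+1 is chosen.  No point may be an endpoint of
-- two chosen segments, i.e. no two consecutive entries are true.

noTwoAdjacent : List Bool → Bool
noTwoAdjacent (true ∷ true ∷ _) = false
noTwoAdjacent (_ ∷ r)           = noTwoAdjacent r
noTwoAdjacent []                = true

configs : (m : ℕ) → List (Vec Bool (m ∸ 1))
configs m = filterᵇ (λ c → noTwoAdjacent (toList c)) (allVecs (m ∸ 1) (true ∷ false ∷ []))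

countTrue : List Bool → ℕ
countTrue []          = 0
countTrue (true ∷ r)  = suc (countTrue r)
countTrue (false ∷ r) = countTrue r

-- objects = chosen segments + points that are not endpoints of chosen segments
objects : (m : ℕ) → Vec Bool (m ∸ 1) → ℕ
objects m c = countTrue (toList c) + (m ∸ 2 * countTrue (toList c))

-- b_{k,n}: pairs of configurations with equally many objects on both lines.
-- (For k = n = 0 this evaluates to 1, matching the convention b_{0,0} = 1.)
b : ℕ → ℕ → ℕ
b k n = length (filterᵇ (λ { (c , d) → (objects k c ≡ᵇ objects n d) })
                        (cartesianProduct (configs k) (configs n)))

module Submission where

-- In a noncrossing pairing, a segment joining two points of the same line would
-- contain every marked point between its endpoints, so it joins neighbours.  The
-- remaining (free) points are paired across the lines, and as these segments do not
-- cross, the r-th free point of one line is paired with the r-th free point of the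
-- other.  So a pairing is determined by the two configurations of neighbour segments
-- it induces, which have equally many free points; conversely any two such
-- configurations assemble to a noncrossing pairing.  As #free + 2·#segments = n on a
-- line, equally many free points means equally many objects, the condition of b.

open import Defs
open import Data.Bool using (Bool; true; false; _∧_; _∨_; not; T; if_then_else_)
open import Data.Bool.ListAction using (and)
open import Data.Bool.Properties using (T-≡; T-∧; T-∨; ∧-conicalˡ; ∧-conicalʳ; not-involutive; ∧-comm; ∨-comm; ∧-zeroʳ; ∧-identityʳ; ¬-not)
open import Data.Empty using (⊥; ⊥-elim)
open import Data.Fin using (Fin; toℕ; zero; suc; splitAt; join; inject₁; pred; fromℕ<)
open import Data.Fin.Properties using (toℕ-injective; splitAt-join; join-splitAt; toℕ-inject₁; toℕ<n; toℕ-fromℕ<)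
open import Data.List using (List; []; _∷_; _++_; map; filterᵇ; length; allFin; cartesianProduct)
import Data.List as List
open import Data.List.Properties using (length-++; length-map; filter-accept; filter-reject; filter-≐; filter-none; filter-notAll)
open import Data.List.Membership.Propositional using (_∈_)
import Data.List.Membership.Propositional.Properties as ∈P
open import Data.List.Relation.Unary.All using (All; []; _∷_)
import Data.List.Relation.Unary.All as All
import Data.List.Relation.Unary.All.Properties as AllP
open import Data.List.Relation.Unary.AllPairs as AllPairs using (AllPairs; []; _∷_)
import Data.List.Relation.Unary.AllPairs.Properties as AllPairsP
open import Data.List.Relation.Unary.Any using (here; there)
import Data.List.Relation.Unary.Any as Any
import Data.List.Relation.Unary.Any.Properties as AnyP
open import Data.List.Relation.Unary.Unique.Propositional using (Unique)
import Data.List.Relation.Unary.Unique.Propositional.Properties as UniqueP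
open import Data.Maybe using (Maybe; just; nothing)
import Data.Maybe as Maybe
open import Data.Nat using (ℕ; zero; suc; _+_; _∸_; _*_; _≤_; _<_; z≤n; s≤s; _≡ᵇ_; _<ᵇ_; _≤ᵇ_; _≟_)
open import Data.Nat.Properties
open import Data.Nat.Tactic.RingSolver using (solve-∀)
open import Data.Product using (_×_; _,_; proj₁; proj₂; ∃-syntax) renaming (map₂ to ×-map₂)
import Data.Product as Product
open import Data.Sum using (_⊎_; inj₁; inj₂; swap; reduce)
open import Data.Sum.Properties using (swap-involutive; inj₁-injective; inj₂-injective)
open import Data.Unit using (tt)
open import Data.Vec using (Vec; lookup; tabulate; toList) renaming ([] to []ᵥ; _∷_ to _∷ᵥ_)
open import Data.Vec.Properties using (lookup∘tabulate; tabulate∘lookup; tabulate-cong; ∷-injectiveʳ)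
open import Function using (_∘_; id; Equivalence)
open import Relation.Binary.Definitions using (tri<; tri≈; tri>)
open import Relation.Binary.PropositionalEquality
open import Relation.Nullary.Decidable using (T?; yes; no)

T⇒≡true : ∀ {b} → T b → b ≡ true
T⇒≡true = Equivalence.to T-≡

¬T⇒≡false : ∀ {b} → (T b → ⊥) → b ≡ false
¬T⇒≡false {false} _  = refl
¬T⇒≡false {true}  ¬t = ⊥-elim (¬t tt)

true≢false : true ≢ false
true≢false ()

∧-intro : ∀ {a b} → a ≡ true → b ≡ true → a ∧ b ≡ true
∧-intro refl refl = refl

not≡true⇒≡false : ∀ {b} → not b ≡ true → b ≡ false
not≡true⇒≡false {b} e = trans (sym (not-involutive b)) (cong not e)

-- The shape 'not (not a ∧ not b ∧ c)' of the segment condition in 'validPairing':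
-- c may only hold when a or b does.
nand-elim : ∀ {a b c} → not (not a ∧ not b ∧ c) ≡ true → a ≡ false → b ≡ false → c ≡ false
nand-elim e refl refl = not≡true⇒≡false e

nand-intro : ∀ a b {c} → (a ≡ false → b ≡ false → c ≡ false) → not (not a ∧ not b ∧ c) ≡ true
nand-intro true  _     _ = refl
nand-intro false true  _ = refl
nand-intro false false h = cong not (h refl refl)

≡ᵇ⇒≡′ : ∀ m n → (m ≡ᵇ n) ≡ true → m ≡ n
≡ᵇ⇒≡′ m n e = ≡ᵇ⇒≡ m n (Equivalence.from T-≡ e)

≡⇒≡ᵇ′ : ∀ {m n} → m ≡ n → (m ≡ᵇ n) ≡ true
≡⇒≡ᵇ′ {m} {n} m≡n = T⇒≡true (≡⇒≡ᵇ m n m≡n)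

≢⇒≡ᵇ-false : ∀ {m n} → m ≢ n → (m ≡ᵇ n) ≡ false
≢⇒≡ᵇ-false {m} {n} m≢n = ¬T⇒≡false (m≢n ∘ ≡ᵇ⇒≡ m n)

<ᵇ-true : ∀ {m n} → m < n → (m <ᵇ n) ≡ true
<ᵇ-true m<n = T⇒≡true (<⇒<ᵇ m<n)

<ᵇ-false : ∀ {m n} → n ≤ m → (m <ᵇ n) ≡ false
<ᵇ-false {m} {n} n≤m = ¬T⇒≡false (λ t → <⇒≱ (<ᵇ⇒< m n t) n≤m)

forallFin⇒ : ∀ {m} (P : Fin m → Bool) → forallFin m P ≡ true → ∀ i → P i ≡ true
forallFin⇒ {m} P all i = and-map (allFin m) all (∈P.∈-allFin i)
  where
  and-map : ∀ xs → and (map P xs) ≡ true → ∀ {x} → x ∈ xs → P x ≡ true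
  and-map (y ∷ ys) all (here refl) = ∧-conicalˡ (P y) _ all
  and-map (y ∷ ys) all (there x∈) = and-map ys (∧-conicalʳ (P y) _ all) x∈

⇒forallFin : ∀ {m} {P : Fin m → Bool} → (∀ i → P i ≡ true) → forallFin m P ≡ true
⇒forallFin {m} {P} holds = and-map (allFin m)
  where
  and-map : ∀ xs → and (map P xs) ≡ true
  and-map []       = refl
  and-map (y ∷ ys) = ∧-intro (holds y) (and-map ys)

eqFin⇒≡ : ∀ {m} {x y : Fin m} → eqFin x y ≡ true → x ≡ y
eqFin⇒≡ {x = x} {y} e = toℕ-injective (≡ᵇ⇒≡′ (toℕ x) (toℕ y) e)

eqFin-refl : ∀ {m} (x : Fin m) → eqFin x x ≡ true
eqFin-refl x = ≡⇒≡ᵇ′ {toℕ x} refl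

≡⇒eqFin : ∀ {m} {x y : Fin m} → x ≡ y → eqFin x y ≡ true
≡⇒eqFin {x = x} refl = eqFin-refl x

≢⇒eqFin-false : ∀ {m} {x y : Fin m} → x ≢ y → eqFin x y ≡ false
≢⇒eqFin-false x≢y = ≢⇒≡ᵇ-false (x≢y ∘ toℕ-injective)

eqFin-false⇒≢ : ∀ {m} {x y : Fin m} → eqFin x y ≡ false → x ≢ y
eqFin-false⇒≢ e x≡y = true≢false (trans (sym (≡⇒eqFin x≡y)) e)

filterᵇ-accept : ∀ {A : Set} (p : A → Bool) {x} xs → p x ≡ true → filterᵇ p (x ∷ xs) ≡ x ∷ filterᵇ p xs
filterᵇ-accept p xs px = filter-accept (T? ∘ p) (Equivalence.from T-≡ px)

filterᵇ-reject : ∀ {A : Set} (p : A → Bool) {x} xs → p x ≡ false → filterᵇ p (x ∷ xs) ≡ filterᵇ p xs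
filterᵇ-reject p xs ¬px = filter-reject (T? ∘ p) (λ t → subst T ¬px t)

∈-filterᵇ⁺ : ∀ {A : Set} (p : A → Bool) {x xs} → x ∈ xs → p x ≡ true → x ∈ filterᵇ p xs
∈-filterᵇ⁺ p x∈ px = ∈P.∈-filter⁺ (T? ∘ p) x∈ (Equivalence.from T-≡ px)

∈-filterᵇ⁻ : ∀ {A : Set} (p : A → Bool) {x xs} → x ∈ filterᵇ p xs → x ∈ xs × p x ≡ true
∈-filterᵇ⁻ p x∈ = ×-map₂ (Equivalence.to T-≡) (∈P.∈-filter⁻ (T? ∘ p) x∈)

filterᵇ-cong : ∀ {A : Set} {p q : A → Bool} → (∀ x → p x ≡ q x) → ∀ xs → filterᵇ p xs ≡ filterᵇ q xs
filterᵇ-cong p≗q = filter-≐ (T? ∘ _) (T? ∘ _) ((λ {x} → subst T (p≗q x)) , (λ {x} → subst T (sym (p≗q x))))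

filterᵇ-filterᵇ : ∀ {A : Set} (P Q : A → Bool) xs → filterᵇ Q (filterᵇ P xs) ≡ filterᵇ (λ x → P x ∧ Q x) xs
filterᵇ-filterᵇ P Q []       = refl
filterᵇ-filterᵇ P Q (x ∷ xs) with P x
... | false = filterᵇ-filterᵇ P Q xs
... | true with Q x
...   | true  = cong (x ∷_) (filterᵇ-filterᵇ P Q xs)
...   | false = filterᵇ-filterᵇ P Q xs

length-filterᵇ-tabulate : ∀ {A : Set} {m} (P : A → Bool) (f : Fin m → A) →
  length (filterᵇ P (List.tabulate f)) ≡ length (filterᵇ (P ∘ f) (allFin m))
length-filterᵇ-tabulate {m = zero}  P f = refl
length-filterᵇ-tabulate {m = suc m} P f with P (f zero)
... | true  = cong suc (trans (length-filterᵇ-tabulate P (f ∘ suc)) (sym (length-filterᵇ-tabulate (P ∘ f) suc)))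
... | false = trans (length-filterᵇ-tabulate P (f ∘ suc)) (sym (length-filterᵇ-tabulate (P ∘ f) suc))

unique-⊆⇒length-≤ : ∀ {A : Set} {xs ys : List A} → Unique xs → (∀ {x} → x ∈ xs → x ∈ ys) → length xs ≤ length ys
unique-⊆⇒length-≤ {xs = []} _ _ = z≤n
unique-⊆⇒length-≤ {xs = x ∷ xs} {ys} (x∉xs ∷ xs!) xs⊆ys with ∈P.∈-∃++ (xs⊆ys (here refl))
... | ys₁ , ys₂ , refl = begin
  suc (length xs)                ≤⟨ s≤s (unique-⊆⇒length-≤ xs! xs⊆ys₁ys₂) ⟩
  suc (length (ys₁ ++ ys₂))      ≡⟨ cong suc (length-++ ys₁) ⟩
  suc (length ys₁ + length ys₂)  ≡⟨ sym (+-suc (length ys₁) (length ys₂)) ⟩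
  length ys₁ + length (x ∷ ys₂)  ≡⟨ sym (length-++ ys₁) ⟩
  length (ys₁ ++ x ∷ ys₂)        ∎
  where
  open ≤-Reasoning
  drop-x : ∀ {z} zs → z ∈ zs ++ x ∷ ys₂ → z ≢ x → z ∈ zs ++ ys₂
  drop-x []       (here refl) z≢x = ⊥-elim (z≢x refl)
  drop-x []       (there z∈)  _   = z∈
  drop-x (_ ∷ zs) (here refl) _   = here refl
  drop-x (_ ∷ zs) (there z∈)  z≢x = there (drop-x zs z∈ z≢x)
  xs⊆ys₁ys₂ : ∀ {z} → z ∈ xs → z ∈ ys₁ ++ ys₂
  xs⊆ys₁ys₂ z∈xs = drop-x ys₁ (xs⊆ys (there z∈xs)) (λ z≡x → All.lookup x∉xs z∈xs (sym z≡x))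

map-unique : ∀ {A B : Set} (f : A → B) {xs : List A} → Unique xs →
             (∀ {x y} → x ∈ xs → y ∈ xs → f x ≡ f y → x ≡ y) → Unique (map f xs)
map-unique f {[]}     []           _   = []
map-unique f {x ∷ xs} (x∉xs ∷ xs!) inj =
  AllP.map⁺ (All.tabulate (λ y∈xs fx≡fy → All.lookup x∉xs y∈xs (inj (here refl) (there y∈xs) fx≡fy)))
  ∷ map-unique f xs! (λ x∈ y∈ → inj (there x∈) (there y∈))

count-≤ : ∀ {A B : Set} (p : A → Bool) (q : B → Bool) {xs : List A} {ys : List B} (f : A → B) →
  Unique xs →
  (∀ {x} → x ∈ xs → p x ≡ true → f x ∈ ys × q (f x) ≡ true) →
  (∀ {x y} → x ∈ xs → y ∈ xs → p x ≡ true → p y ≡ true → f x ≡ f y → x ≡ y) →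
  length (filterᵇ p xs) ≤ length (filterᵇ q ys)
count-≤ p q {xs} {ys} f xs! maps-to inj = begin
  length (filterᵇ p xs)          ≡⟨ sym (length-map f (filterᵇ p xs)) ⟩
  length (map f (filterᵇ p xs))  ≤⟨ unique-⊆⇒length-≤ image! image⊆ ⟩
  length (filterᵇ q ys)          ∎
  where
  open ≤-Reasoning
  image! : Unique (map f (filterᵇ p xs))
  image! = map-unique f (UniqueP.filter⁺ _ xs!) λ x∈ y∈ →
    let (x∈xs , px) = ∈-filterᵇ⁻ p x∈ ; (y∈ys , py) = ∈-filterᵇ⁻ p y∈ in inj x∈xs y∈ys px py
  image⊆ : ∀ {z} → z ∈ map f (filterᵇ p xs) → z ∈ filterᵇ q ys
  image⊆ z∈ with ∈P.∈-map⁻ f z∈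
  ... | x , x∈ , refl = let (x∈xs , px) = ∈-filterᵇ⁻ p x∈ ; (fx∈ys , qfx) = maps-to x∈xs px in
    ∈-filterᵇ⁺ q fx∈ys qfx

count-≡ : ∀ {A B : Set} (p : A → Bool) (q : B → Bool) {xs : List A} {ys : List B} (f : A → B) (g : B → A) →
  Unique xs → Unique ys →
  (∀ {x} → x ∈ xs → p x ≡ true → f x ∈ ys × q (f x) ≡ true) →
  (∀ {y} → y ∈ ys → q y ≡ true → g y ∈ xs × p (g y) ≡ true) →
  (∀ {x} → x ∈ xs → p x ≡ true → g (f x) ≡ x) →
  (∀ {y} → y ∈ ys → q y ≡ true → f (g y) ≡ y) →
  length (filterᵇ p xs) ≡ length (filterᵇ q ys)
count-≡ p q f g xs! ys! f-maps g-maps gf fg = ≤-antisym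
  (count-≤ p q f xs! f-maps (λ x∈ y∈ px py fx≡fy → trans (sym (gf x∈ px)) (trans (cong g fx≡fy) (gf y∈ py))))
  (count-≤ q p g ys! g-maps (λ x∈ y∈ qx qy gx≡gy → trans (sym (fg x∈ qx)) (trans (cong f gx≡gy) (fg y∈ qy))))

∈-allVecs : ∀ {A : Set} {m} (xs : List A) → (∀ {x} → x ∈ xs) → (v : Vec A m) → v ∈ allVecs m xs
∈-allVecs xs _    []ᵥ       = here refl
∈-allVecs {m = suc m} xs x∈xs (x ∷ᵥ v) =
  ∈P.∈-concat⁺ (AnyP.map⁺ (Any.map (λ { refl → ∈P.∈-map⁺ (x ∷ᵥ_) (∈-allVecs xs x∈xs v) }) x∈xs))

allVecs-unique : ∀ {A : Set} m (xs : List A) → Unique xs → Unique (allVecs m xs)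
allVecs-unique zero    xs xs! = [] ∷ []
allVecs-unique (suc m) xs xs! =
  UniqueP.concat⁺ (AllP.map⁺ (All.tabulate (λ _ → UniqueP.map⁺ ∷-injectiveʳ (allVecs-unique m xs xs!))))
                  (AllPairsP.map⁺ (AllPairs.map disjoint xs!))
  where
  disjoint : ∀ {x y} → x ≢ y → ∀ {v} → v ∈ map (x ∷ᵥ_) (allVecs m xs) × v ∈ map (y ∷ᵥ_) (allVecs m xs) → ⊥
  disjoint x≢y (v∈x , v∈y) with ∈P.∈-map⁻ _ v∈x | ∈P.∈-map⁻ _ v∈y
  ... | _ , _ , refl | _ , _ , refl = x≢y refl

nth : ∀ {A : Set} → A → List A → ℕ → A
nth d []       _       = d
nth d (x ∷ xs) zero    = x
nth d (x ∷ xs) (suc r) = nth d xs r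

Increasing : ∀ {m} → List (Fin m) → Set
Increasing = AllPairs (λ x y → toℕ x < toℕ y)

rankIn : ∀ {m} → List (Fin m) → Fin m → ℕ
rankIn xs x = length (filterᵇ (λ y → toℕ y <ᵇ toℕ x) xs)

module Ranks {m : ℕ} (d : Fin m) where

  private
    rank-of-least : ∀ {y : Fin m} {ys} → All (λ z → toℕ y < toℕ z) ys → rankIn (y ∷ ys) y ≡ 0
    rank-of-least {y} {ys} y<ys = begin
      length (filterᵇ (λ z → toℕ z <ᵇ toℕ y) (y ∷ ys))  ≡⟨ cong length (filterᵇ-reject _ ys (<ᵇ-false (≤-refl {toℕ y}))) ⟩
      length (filterᵇ (λ z → toℕ z <ᵇ toℕ y) ys)        ≡⟨ cong length (filter-none (T? ∘ _) (All.map not-below y<ys)) ⟩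
      0                                                 ∎
      where
      open ≡-Reasoning
      not-below : ∀ {z} → toℕ y < toℕ z → T (toℕ z <ᵇ toℕ y) → ⊥
      not-below y<z t = <-asym y<z (<ᵇ⇒< _ _ t)

    rank-past-least : ∀ {y : Fin m} {ys x} → toℕ y < toℕ x → rankIn (y ∷ ys) x ≡ suc (rankIn ys x)
    rank-past-least {ys = ys} y<x = cong length (filterᵇ-accept _ ys (<ᵇ-true y<x))

  nth-∈ : ∀ xs r → r < length xs → nth d xs r ∈ xs
  nth-∈ (x ∷ xs) zero    _         = here refl
  nth-∈ (x ∷ xs) (suc r) (s≤s r<n) = there (nth-∈ xs r r<n)

  rank<length : ∀ {xs : List (Fin m)} {x} → x ∈ xs → rankIn xs x < length xs
  rank<length {xs} {x} x∈ = filter-notAll (T? ∘ _) xs (Any.map (λ { refl t → <-irrefl refl (<ᵇ⇒< (toℕ x) (toℕ x) t) }) x∈)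

  nth-rank : ∀ {xs : List (Fin m)} {x} → Increasing xs → x ∈ xs → nth d xs (rankIn xs x) ≡ x
  nth-rank {y ∷ ys} (y<ys ∷ _)   (here refl) = cong (nth d (y ∷ ys)) (rank-of-least y<ys)
  nth-rank {y ∷ ys} (y<ys ∷ inc) (there x∈)  =
    trans (cong (nth d (y ∷ ys)) (rank-past-least (All.lookup y<ys x∈))) (nth-rank inc x∈)

  rank-nth : ∀ {xs : List (Fin m)} r → Increasing xs → r < length xs → rankIn xs (nth d xs r) ≡ r
  rank-nth zero    (y<ys ∷ _)   _         = rank-of-least y<ys
  rank-nth {_ ∷ xs} (suc r) (y<ys ∷ inc) (s≤s r<n) =
    trans (rank-past-least (All.lookup y<ys (nth-∈ xs r r<n))) (cong suc (rank-nth r inc r<n))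

  nth-increasing : ∀ {xs : List (Fin m)} {r r′} → Increasing xs → r < r′ → r′ < length xs → toℕ (nth d xs r) < toℕ (nth d xs r′)
  nth-increasing {_ ∷ xs} {zero}  {suc r′} (y<ys ∷ _)   _         (s≤s r′<n) = All.lookup y<ys (nth-∈ xs r′ r′<n)
  nth-increasing {_ ∷ xs} {suc r} {suc r′} (_ ∷ inc)   (s≤s r<r′) (s≤s r′<n) = nth-increasing inc r<r′ r′<n

record IsNoncrossingPairing {p q : ℕ} (σ : Pos p q → Pos p q) : Set where
  field
    involutive    : ∀ u → σ (σ u) ≡ u
    fixpoint-free : ∀ u → σ u ≢ u
    segment-clear : ∀ u w → w ≢ u → w ≢ σ u → onSeg u (σ u) w ≡ false
    noncrossing   : ∀ u v → crossPairs (asCross u (σ u)) (asCross v (σ v)) ≡ false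

  partner-sym : ∀ {u v} → σ u ≡ v → σ v ≡ u
  partner-sym {u} σu≡v = trans (cong σ (sym σu≡v)) (involutive u)

module Encoding (p q : ℕ) where

  decode : Vec (Fin (p + q)) (p + q) → Pos p q → Pos p q
  decode f u = splitAt p (lookup f (join p q u))

  encode : (Pos p q → Pos p q) → Vec (Fin (p + q)) (p + q)
  encode σ = tabulate (λ x → join p q (σ (splitAt p x)))

  decode-encode : ∀ σ u → decode (encode σ) u ≡ σ u
  decode-encode σ u = begin
    splitAt p (lookup (encode σ) (join p q u))         ≡⟨ cong (splitAt p) (lookup∘tabulate _ (join p q u)) ⟩
    splitAt p (join p q (σ (splitAt p (join p q u))))  ≡⟨ splitAt-join p q _ ⟩
    σ (splitAt p (join p q u))                         ≡⟨ cong σ (splitAt-join p q u) ⟩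
    σ u                                                ∎
    where open ≡-Reasoning

  encode-decode : ∀ f → encode (decode f) ≡ f
  encode-decode f = begin
    tabulate (λ x → join p q (splitAt p (lookup f (join p q (splitAt p x)))))  ≡⟨ tabulate-cong (λ x → join-splitAt p q _) ⟩
    tabulate (λ x → lookup f (join p q (splitAt p x)))                         ≡⟨ tabulate-cong (λ x → cong (lookup f) (join-splitAt p q x)) ⟩
    tabulate (lookup f)                                                        ≡⟨ tabulate∘lookup f ⟩
    f                                                                          ∎
    where open ≡-Reasoning

  encode-cong : ∀ {σ τ} → (∀ u → σ u ≡ τ u) → encode σ ≡ encode τ
  encode-cong σ≗τ = tabulate-cong (λ x → cong (join p q) (σ≗τ (splitAt p x)))

  all-positions : (P : Pos p q → Set) → (∀ x → P (splitAt p x)) → ∀ u → P u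
  all-positions P h u = subst P (splitAt-join p q u) (h (join p q u))

  splitAt-injective : ∀ {x y} → splitAt p x ≡ splitAt p y → x ≡ y
  splitAt-injective {x} {y} e = trans (sym (join-splitAt p q x)) (trans (cong (join p q) e) (join-splitAt p q y))

  decode-splitAt : ∀ f x → decode f (splitAt p x) ≡ splitAt p (lookup f x)
  decode-splitAt f x = cong (splitAt p ∘ lookup f) (join-splitAt p q x)

  splitAt-encode : ∀ σ x → splitAt p (lookup (encode σ) x) ≡ σ (splitAt p x)
  splitAt-encode σ x = trans (cong (splitAt p) (lookup∘tabulate _ x)) (splitAt-join p q _)

  module Conjuncts (f : Vec (Fin (p + q)) (p + q)) where
    private
      m = p + q
      pos = splitAt p
      partner = lookup f

    isInvolution isFixpointFree isClear isUncrossed : Bool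
    isInvolution = forallFin m (λ x → eqFin (partner (partner x)) x)
    isFixpointFree = forallFin m (λ x → not (eqFin (partner x) x))
    isClear = forallFin m (λ x → forallFin m (λ z →
      not (not (eqFin z x) ∧ not (eqFin z (partner x)) ∧ onSeg (pos x) (pos (partner x)) (pos z))))
    isUncrossed = forallFin m (λ x → forallFin m (λ y →
      not (crossPairs (asCross (pos x) (pos (partner x))) (asCross (pos y) (pos (partner y))))))

    conjuncts : validPairing p q f ≡ true →
                isInvolution ≡ true × isFixpointFree ≡ true × isClear ≡ true × isUncrossed ≡ true
    conjuncts valid = ∧-conicalˡ isInvolution _ valid , ∧-conicalˡ isFixpointFree _ rest₁ ,
                      ∧-conicalˡ isClear _ rest₂ , ∧-conicalʳ isClear _ rest₂
      where
      rest₁ = ∧-conicalʳ isInvolution _ valid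
      rest₂ = ∧-conicalʳ isFixpointFree _ rest₁

  validPairing⇒noncrossing : ∀ f → validPairing p q f ≡ true → IsNoncrossingPairing (decode f)
  validPairing⇒noncrossing f valid = record
    { involutive    = all-positions (λ u → σ (σ u) ≡ u) λ x → begin
        σ (σ (pos x))               ≡⟨ cong σ (decode-splitAt f x) ⟩
        σ (pos (partner x))         ≡⟨ decode-splitAt f (partner x) ⟩
        pos (partner (partner x))   ≡⟨ cong pos (eqFin⇒≡ (forallFin⇒ _ involution x)) ⟩
        pos x                       ∎
    ; fixpoint-free = all-positions (λ u → σ u ≢ u) λ x σx≡x →
        eqFin-false⇒≢ (not≡true⇒≡false (forallFin⇒ _ no-fixpoint x))
          (splitAt-injective (trans (sym (decode-splitAt f x)) σx≡x))
    ; segment-clear = all-positions (λ u → ∀ w → w ≢ u → w ≢ σ u → onSeg u (σ u) w ≡ false) λ x →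
        all-positions (λ w → w ≢ pos x → w ≢ σ (pos x) → onSeg (pos x) (σ (pos x)) w ≡ false) λ z z≢x z≢σx →
          subst (λ v → onSeg (pos x) v (pos z) ≡ false) (sym (decode-splitAt f x))
            (nand-elim (forallFin⇒ _ (forallFin⇒ _ clear x) z)
              (≢⇒eqFin-false (z≢x ∘ cong pos))
              (≢⇒eqFin-false (λ z≡fx → z≢σx (trans (cong pos z≡fx) (sym (decode-splitAt f x))))))
    ; noncrossing   = all-positions (λ u → ∀ v → crossPairs (asCross u (σ u)) (asCross v (σ v)) ≡ false) λ x →
        all-positions (λ v → crossPairs (asCross (pos x) (σ (pos x))) (asCross v (σ v)) ≡ false) λ y →
          subst₂ (λ a b → crossPairs (asCross (pos x) a) (asCross (pos y) b) ≡ false)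
            (sym (decode-splitAt f x)) (sym (decode-splitAt f y))
            (not≡true⇒≡false (forallFin⇒ _ (forallFin⇒ _ uncrossed x) y))
    }
    where
    open ≡-Reasoning
    σ = decode f
    pos = splitAt p
    partner = lookup f
    open Conjuncts f
    involution = proj₁ (conjuncts valid)
    no-fixpoint = proj₁ (proj₂ (conjuncts valid))
    clear = proj₁ (proj₂ (proj₂ (conjuncts valid)))
    uncrossed = proj₂ (proj₂ (proj₂ (conjuncts valid)))

  noncrossing⇒validPairing : ∀ σ → IsNoncrossingPairing σ → validPairing p q (encode σ) ≡ true
  noncrossing⇒validPairing σ V =
    ∧-intro (⇒forallFin involution) (∧-intro (⇒forallFin no-fixpoint)
      (∧-intro (⇒forallFin (⇒forallFin ∘ clear)) (⇒forallFin (⇒forallFin ∘ uncrossed))))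
    where
    open IsNoncrossingPairing V
    f = encode σ
    pos = splitAt p
    pos-f : ∀ x → pos (lookup f x) ≡ σ (pos x)
    pos-f = splitAt-encode σ
    involution : ∀ x → eqFin (lookup f (lookup f x)) x ≡ true
    involution x = ≡⇒eqFin (splitAt-injective (begin
      pos (lookup f (lookup f x))  ≡⟨ pos-f (lookup f x) ⟩
      σ (pos (lookup f x))         ≡⟨ cong σ (pos-f x) ⟩
      σ (σ (pos x))                ≡⟨ involutive (pos x) ⟩
      pos x                        ∎))
      where open ≡-Reasoning
    no-fixpoint : ∀ x → not (eqFin (lookup f x) x) ≡ true
    no-fixpoint x = cong not (≢⇒eqFin-false λ fx≡x → fixpoint-free (pos x) (trans (sym (pos-f x)) (cong pos fx≡x)))
    clear : ∀ x z → not (not (eqFin z x) ∧ not (eqFin z (lookup f x)) ∧ onSeg (pos x) (pos (lookup f x)) (pos z)) ≡ true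
    clear x z = nand-intro (eqFin z x) (eqFin z (lookup f x)) λ z≢x z≢fx →
      subst (λ v → onSeg (pos x) v (pos z) ≡ false) (sym (pos-f x))
        (segment-clear (pos x) (pos z) (eqFin-false⇒≢ z≢x ∘ splitAt-injective)
          (λ e → eqFin-false⇒≢ z≢fx (splitAt-injective (trans e (sym (pos-f x))))))
    uncrossed : ∀ x y → not (crossPairs (asCross (pos x) (pos (lookup f x))) (asCross (pos y) (pos (lookup f y)))) ≡ true
    uncrossed x y rewrite pos-f x | pos-f y = cong not (noncrossing (pos x) (pos y))

-- This symmetry halves the work below: every statement about the
-- points of the first line transfers to the second.
mirror : ∀ {p q} → (Pos p q → Pos p q) → Pos q p → Pos q p
mirror σ = swap ∘ σ ∘ swap

mirror-swap : ∀ {p q} (σ : Pos p q → Pos p q) u → mirror σ (swap u) ≡ swap (σ u)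
mirror-swap σ u = cong (swap ∘ σ) (swap-involutive u)

mirror-involutive : ∀ {p q} (σ : Pos p q → Pos p q) u → mirror (mirror σ) u ≡ σ u
mirror-involutive σ u = trans (swap-involutive _) (cong σ (swap-involutive u))

swap-injective : ∀ {p q} {u v : Pos p q} → swap u ≡ swap v → u ≡ v
swap-injective {u = u} {v} e = trans (sym (swap-involutive u)) (trans (cong swap e) (swap-involutive v))

onSeg-swap : ∀ {p q} (u v w : Pos p q) → onSeg (swap u) (swap v) (swap w) ≡ onSeg u v w
onSeg-swap (inj₁ _) (inj₁ _) (inj₁ _) = refl
onSeg-swap (inj₁ _) (inj₁ _) (inj₂ _) = refl
onSeg-swap (inj₁ _) (inj₂ _) _        = refl
onSeg-swap (inj₂ _) (inj₁ _) _        = refl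
onSeg-swap (inj₂ _) (inj₂ _) (inj₁ _) = refl
onSeg-swap (inj₂ _) (inj₂ _) (inj₂ _) = refl

asCross-swap : ∀ {p q} (u v : Pos p q) → asCross (swap u) (swap v) ≡ Maybe.map Product.swap (asCross u v)
asCross-swap (inj₁ _) (inj₁ _) = refl
asCross-swap (inj₁ _) (inj₂ _) = refl
asCross-swap (inj₂ _) (inj₁ _) = refl
asCross-swap (inj₂ _) (inj₂ _) = refl

crossPairs-swap : ∀ x y → crossPairs (Maybe.map Product.swap x) (Maybe.map Product.swap y) ≡ crossPairs x y
crossPairs-swap nothing         _                 = refl
crossPairs-swap (just _)        nothing           = refl
crossPairs-swap (just (i , j)) (just (i′ , j′)) = trans (∨-comm ((j <ᵇ j′) ∧ (i′ <ᵇ i)) _)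
  (cong₂ _∨_ (∧-comm (j′ <ᵇ j) (i <ᵇ i′)) (∧-comm (j <ᵇ j′) (i′ <ᵇ i)))

crossPairs-comm : ∀ x y → crossPairs x y ≡ crossPairs y x
crossPairs-comm nothing         nothing           = refl
crossPairs-comm nothing         (just _)          = refl
crossPairs-comm (just _)        nothing           = refl
crossPairs-comm (just (i , j)) (just (i′ , j′)) = ∨-comm ((i <ᵇ i′) ∧ (j′ <ᵇ j)) _

mirror-noncrossing : ∀ {p q} {σ : Pos p q → Pos p q} → IsNoncrossingPairing σ → IsNoncrossingPairing (mirror σ)
mirror-noncrossing {p} {q} {σ} V = record
  { involutive    = at-swaps (λ u → τ (τ u) ≡ u) λ u → begin
      τ (τ (swap u))      ≡⟨ cong τ (mirror-swap σ u) ⟩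
      τ (swap (σ u))      ≡⟨ mirror-swap σ (σ u) ⟩
      swap (σ (σ u))      ≡⟨ cong swap (involutive u) ⟩
      swap u              ∎
  ; fixpoint-free = at-swaps (λ u → τ u ≢ u) λ u e → fixpoint-free u (swap-injective (trans (sym (mirror-swap σ u)) e))
  ; segment-clear = at-swaps (λ u → ∀ w → w ≢ u → w ≢ τ u → onSeg u (τ u) w ≡ false) λ u →
      at-swaps (λ w → w ≢ swap u → w ≢ τ (swap u) → onSeg (swap u) (τ (swap u)) w ≡ false) λ w w≢u w≢σu →
        begin
          onSeg (swap u) (τ (swap u)) (swap w)   ≡⟨ cong (λ v → onSeg (swap u) v (swap w)) (mirror-swap σ u) ⟩
          onSeg (swap u) (swap (σ u)) (swap w)   ≡⟨ onSeg-swap u (σ u) w ⟩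
          onSeg u (σ u) w                        ≡⟨ segment-clear u w (w≢u ∘ cong swap)
                                                      (λ e → w≢σu (trans (cong swap e) (sym (mirror-swap σ u)))) ⟩
          false                                  ∎
  ; noncrossing   = at-swaps (λ u → ∀ v → crossPairs (asCross u (τ u)) (asCross v (τ v)) ≡ false) λ u →
      at-swaps (λ v → crossPairs (asCross (swap u) (τ (swap u))) (asCross v (τ v)) ≡ false) λ v → begin
        crossPairs (asCross (swap u) (τ (swap u))) (asCross (swap v) (τ (swap v)))
          ≡⟨ cong₂ (λ a b → crossPairs (asCross (swap u) a) (asCross (swap v) b)) (mirror-swap σ u) (mirror-swap σ v) ⟩
        crossPairs (asCross (swap u) (swap (σ u))) (asCross (swap v) (swap (σ v)))
          ≡⟨ cong₂ crossPairs (asCross-swap u (σ u)) (asCross-swap v (σ v)) ⟩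
        crossPairs (Maybe.map Product.swap (asCross u (σ u))) (Maybe.map Product.swap (asCross v (σ v)))
          ≡⟨ crossPairs-swap (asCross u (σ u)) (asCross v (σ v)) ⟩
        crossPairs (asCross u (σ u)) (asCross v (σ v))
          ≡⟨ noncrossing u v ⟩
        false ∎
  }
  where
  open IsNoncrossingPairing V
  open ≡-Reasoning
  τ = mirror σ
  at-swaps : (P : Pos q p → Set) → (∀ u → P (swap u)) → ∀ u → P u
  at-swaps P h u = subst P (swap-involutive u) (h (swap u))

-- For c : Vec Bool k, 'rightSeg c i' says
-- that the segment from point i to point i + 1 is chosen, 'leftSegFrom b c i' that the
-- segment ending at point i is chosen, where b plays this role for the first point
-- (b = false on an actual line; general b is needed to run inductions along the line).
rightSeg : ∀ {k} → Vec Bool k → Fin (suc k) → Bool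
rightSeg []ᵥ      zero    = false
rightSeg (x ∷ᵥ c) zero    = x
rightSeg (x ∷ᵥ c) (suc i) = rightSeg c i

leftSegFrom : ∀ {k} → Bool → Vec Bool k → Fin (suc k) → Bool
leftSegFrom b c        zero    = b
leftSegFrom b (x ∷ᵥ c) (suc i) = leftSegFrom x c i

leftSeg : ∀ {k} → Vec Bool k → Fin (suc k) → Bool
leftSeg = leftSegFrom false

-- A point is free (a one-point object) if it is an endpoint of no chosen segment.
isFreeFrom : ∀ {k} → Bool → Vec Bool k → Fin (suc k) → Bool
isFreeFrom b c i = not (rightSeg c i) ∧ not (leftSegFrom b c i)

isFree : ∀ {k} → Vec Bool k → Fin (suc k) → Bool
isFree = isFreeFrom false

freePoints : ∀ {k} → Vec Bool k → List (Fin (suc k))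
freePoints {k} c = filterᵇ (isFree c) (allFin (suc k))

rightSeg-inject₁ : ∀ {k} (c : Vec Bool k) j → rightSeg c (inject₁ j) ≡ lookup c j
rightSeg-inject₁ (x ∷ᵥ c) zero    = refl
rightSeg-inject₁ (x ∷ᵥ c) (suc j) = rightSeg-inject₁ c j

rightSeg⇒inject₁ : ∀ {k} (c : Vec Bool k) i → rightSeg c i ≡ true → ∃[ j ] inject₁ j ≡ i
rightSeg⇒inject₁ (x ∷ᵥ c) zero    _ = zero , refl
rightSeg⇒inject₁ (x ∷ᵥ c) (suc i) r with rightSeg⇒inject₁ c i r
... | j , refl = suc j , refl

leftSegFrom-suc : ∀ {k} b (c : Vec Bool k) j → leftSegFrom b c (suc j) ≡ lookup c j
leftSegFrom-suc b (x ∷ᵥ c) zero    = refl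
leftSegFrom-suc b (x ∷ᵥ c) (suc j) = leftSegFrom-suc x c j

noTwoAdjacent⇒ : ∀ {k} b (c : Vec Bool k) → noTwoAdjacent (b ∷ toList c) ≡ true →
                 ∀ i → leftSegFrom b c i ∧ rightSeg c i ≡ false
noTwoAdjacent⇒ b     []ᵥ          _  zero    = ∧-zeroʳ b
noTwoAdjacent⇒ false (x ∷ᵥ c)     _  zero    = refl
noTwoAdjacent⇒ true  (false ∷ᵥ c) _  zero    = refl
noTwoAdjacent⇒ true  (true ∷ᵥ c)  () zero
noTwoAdjacent⇒ false (x ∷ᵥ c)     ok (suc i) = noTwoAdjacent⇒ x c ok i
noTwoAdjacent⇒ true  (false ∷ᵥ c) ok (suc i) = noTwoAdjacent⇒ false c ok i
noTwoAdjacent⇒ true  (true ∷ᵥ c)  () (suc i)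

⇒noTwoAdjacent : ∀ {k} b (c : Vec Bool k) → (∀ i → leftSegFrom b c i ∧ rightSeg c i ≡ false) →
                 noTwoAdjacent (b ∷ toList c) ≡ true
⇒noTwoAdjacent false []ᵥ          _    = refl
⇒noTwoAdjacent true  []ᵥ          _    = refl
⇒noTwoAdjacent false (x ∷ᵥ c)     ok = ⇒noTwoAdjacent x c (ok ∘ suc)
⇒noTwoAdjacent true  (false ∷ᵥ c) ok = ⇒noTwoAdjacent false c (ok ∘ suc)
⇒noTwoAdjacent true  (true ∷ᵥ c)  ok with ok zero
... | ()

left⇒not-right : ∀ {k} (c : Vec Bool k) → noTwoAdjacent (toList c) ≡ true →
                 ∀ {i} → leftSeg c i ≡ true → rightSeg c i ≡ false
left⇒not-right c ok {i} l = trans (cong (_∧ rightSeg c i) (sym l)) (noTwoAdjacent⇒ false c ok i)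

right⇒not-left : ∀ {k} (c : Vec Bool k) → noTwoAdjacent (toList c) ≡ true →
                 ∀ {i} → rightSeg c i ≡ true → leftSeg c i ≡ false
right⇒not-left c ok {i} r = trans (sym (∧-identityʳ _)) (trans (cong (leftSeg c i ∧_) (sym r)) (noTwoAdjacent⇒ false c ok i))

-- Seen from its second point on, the line x ∷ c is the line c whose first point is
-- covered from the left exactly when x is chosen.
free-beyond-first : ∀ {k} b x (c : Vec Bool k) →
  length (filterᵇ (isFreeFrom b (x ∷ᵥ c)) (List.tabulate suc)) ≡ length (filterᵇ (isFreeFrom x c) (allFin (suc k)))
free-beyond-first b x c = length-filterᵇ-tabulate (isFreeFrom b (x ∷ᵥ c)) suc

-- Every point is free or an endpoint of exactly one chosen segment:
-- #free + 2 · #segments is the number of points not covered from the left.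
free+segments : ∀ {k} b (c : Vec Bool k) → noTwoAdjacent (b ∷ toList c) ≡ true →
  length (filterᵇ (isFreeFrom b c) (allFin (suc k))) + 2 * countTrue (toList c) ≡ (if b then k else suc k)
free+segments false []ᵥ            _  = refl
free+segments true  []ᵥ            _  = refl
free+segments false (false ∷ᵥ c) ok =
  cong suc (trans (cong (_+ 2 * countTrue (toList c)) (free-beyond-first false false c)) (free+segments false c ok))
free+segments true  (false ∷ᵥ c) ok =
  trans (cong (_+ 2 * countTrue (toList c)) (free-beyond-first true false c)) (free+segments false c ok)
free+segments true  (true ∷ᵥ c)  ()
free+segments {suc k} false (true ∷ᵥ c) ok = begin
  length (filterᵇ (isFreeFrom false (true ∷ᵥ c)) (List.tabulate suc)) + 2 * suc t
                             ≡⟨ cong (_+ 2 * suc t) (free-beyond-first false true c) ⟩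
  F + 2 * suc t              ≡⟨ cong (F +_) (*-suc 2 t) ⟩
  F + suc (suc (2 * t))      ≡⟨ +-suc F (suc (2 * t)) ⟩
  suc (F + suc (2 * t))      ≡⟨ cong suc (+-suc F (2 * t)) ⟩
  suc (suc (F + 2 * t))      ≡⟨ cong (2 +_) (free+segments true c ok) ⟩
  suc (suc k)                ∎
  where
  open ≡-Reasoning
  t = countTrue (toList c)
  F = length (filterᵇ (isFreeFrom true c) (allFin (suc k)))

free-count : ∀ {k} (c : Vec Bool k) → noTwoAdjacent (toList c) ≡ true →
             length (freePoints c) + 2 * countTrue (toList c) ≡ suc k
free-count = free+segments false

module _ {k : ℕ} (c d : Vec Bool k) (c-ok : noTwoAdjacent (toList c) ≡ true) (d-ok : noTwoAdjacent (toList d) ≡ true) where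

  private
    n = suc k

    free-from-segments : ∀ (e : Vec Bool k) → noTwoAdjacent (toList e) ≡ true →
                         length (freePoints e) ≡ n ∸ 2 * countTrue (toList e)
    free-from-segments e e-ok = sym (trans (cong (_∸ 2 * countTrue (toList e)) (sym (free-count e e-ok)))
                                             (m+n∸n≡m (length (freePoints e)) (2 * countTrue (toList e))))

    objects+segments : ∀ (e : Vec Bool k) → noTwoAdjacent (toList e) ≡ true → objects n e + countTrue (toList e) ≡ n
    objects+segments e e-ok = begin
      t + (n ∸ 2 * t) + t   ≡⟨ cong (λ x → t + x + t) (sym (free-from-segments e e-ok)) ⟩
      t + F + t             ≡⟨ rearrange t F ⟩
      F + 2 * t             ≡⟨ free-count e e-ok ⟩
      n                     ∎
      where
      open ≡-Reasoning
      t = countTrue (toList e)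
      F = length (freePoints e)
      rearrange : ∀ t F → t + F + t ≡ F + 2 * t
      rearrange = solve-∀

    segments-from-objects : ∀ (e : Vec Bool k) → noTwoAdjacent (toList e) ≡ true → countTrue (toList e) ≡ n ∸ objects n e
    segments-from-objects e e-ok = sym (trans (cong (_∸ objects n e) (sym (objects+segments e e-ok)))
                                                (m+n∸m≡n (objects n e) (countTrue (toList e))))

    twice-segments-from-free : ∀ (e : Vec Bool k) → noTwoAdjacent (toList e) ≡ true →
                               2 * countTrue (toList e) ≡ n ∸ length (freePoints e)
    twice-segments-from-free e e-ok = sym (trans (cong (_∸ length (freePoints e)) (sym (free-count e e-ok)))
                                                    (m+n∸m≡n (length (freePoints e)) (2 * countTrue (toList e))))

  equal-free⇒equal-objects : length (freePoints c) ≡ length (freePoints d) → objects n c ≡ objects n d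
  equal-free⇒equal-objects F≡ = cong (λ t → t + (n ∸ 2 * t)) (*-cancelˡ-≡ (countTrue (toList c)) (countTrue (toList d)) 2
    (trans (twice-segments-from-free c c-ok) (trans (cong (n ∸_) F≡) (sym (twice-segments-from-free d d-ok)))))

  equal-objects⇒equal-free : objects n c ≡ objects n d → length (freePoints c) ≡ length (freePoints d)
  equal-objects⇒equal-free O≡ =
    trans (free-from-segments c c-ok) (trans (cong (λ t → n ∸ 2 * t) t≡) (sym (free-from-segments d d-ok)))
    where
    t≡ : countTrue (toList c) ≡ countTrue (toList d)
    t≡ = trans (segments-from-objects c c-ok) (trans (cong (n ∸_) O≡) (sym (segments-from-objects d d-ok)))

-- The right neighbour of a point (the last point is its own).
next : ∀ {k} → Fin (suc k) → Fin (suc k)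
next {zero}  zero    = zero
next {suc k} zero    = suc zero
next {suc k} (suc i) = suc (next i)

next-inject₁ : ∀ {k} (j : Fin k) → next (inject₁ j) ≡ suc j
next-inject₁ {suc k} zero    = refl
next-inject₁ {suc k} (suc j) = cong suc (next-inject₁ j)

leftSeg-suc : ∀ {k} (c : Vec Bool k) i → leftSeg c (suc i) ≡ rightSeg c (inject₁ i)
leftSeg-suc c i = trans (leftSegFrom-suc false c i) (sym (rightSeg-inject₁ c i))

leftSeg-next : ∀ {k} (c : Vec Bool k) {i j} → toℕ i ≡ suc (toℕ j) → leftSeg c i ≡ rightSeg c j
leftSeg-next c {suc i} i≡j+1 =
  trans (leftSeg-suc c i) (cong (rightSeg c) (toℕ-injective (trans (toℕ-inject₁ i) (suc-injective i≡j+1))))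

freePoints-increasing : ∀ {k} (c : Vec Bool k) → Increasing (freePoints c)
freePoints-increasing c = AllPairsP.filter⁺ (T? ∘ isFree c) (AllPairsP.tabulate⁺-< id)

n≢2+n : ∀ n → n ≢ suc (suc n)
n≢2+n n e = <-irrefl e (<-trans (n<1+n n) (n<1+n (suc n)))

strictly-between : ∀ {i j k} → i < k → k < j → between i j k ≡ true
strictly-between i<k k<j rewrite T⇒≡true (≤⇒≤ᵇ (<⇒≤ i<k)) | T⇒≡true (≤⇒≤ᵇ (<⇒≤ k<j)) = refl

-- In a noncrossing pairing, two paired points of the same line are neighbours:
-- any point strictly between them would lie on their segment.
module _ {p q : ℕ} {σ : Pos p q → Pos p q} (V : IsNoncrossingPairing σ) where
  open IsNoncrossingPairing V

  private
    adjacent-forward : ∀ {i j} → toℕ i < toℕ j → σ (inj₁ i) ≡ inj₁ j → toℕ j ≡ suc (toℕ i)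
    adjacent-forward {i} {j} i<j σi≡j with suc (toℕ i) ≟ toℕ j
    ... | yes i+1≡j = sym i+1≡j
    ... | no  i+1≢j = ⊥-elim (true≢false (trans (sym (strictly-between i<k k<j)) k-not-on-segment))
      where
      i+1<j = ≤∧≢⇒< i<j i+1≢j
      k : Fin p
      k = fromℕ< (<-trans i+1<j (toℕ<n j))
      k≡i+1 : toℕ k ≡ suc (toℕ i)
      k≡i+1 = toℕ-fromℕ< _
      i<k : toℕ i < toℕ k
      i<k = subst (toℕ i <_) (sym k≡i+1) (n<1+n (toℕ i))
      k<j : toℕ k < toℕ j
      k<j = subst (_< toℕ j) (sym k≡i+1) i+1<j
      k-not-on-segment : between (toℕ i) (toℕ j) (toℕ k) ≡ false
      k-not-on-segment = subst (λ v → onSeg (inj₁ i) v (inj₁ k) ≡ false) σi≡j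
        (segment-clear (inj₁ i) (inj₁ k) (λ k≡i → <-irrefl (sym (cong toℕ (inj₁-injective k≡i))) i<k)
                                         (λ k≡j → <-irrefl (cong toℕ (inj₁-injective (trans k≡j σi≡j))) k<j))

  adjacent : ∀ {i j} → σ (inj₁ i) ≡ inj₁ j → toℕ j ≡ suc (toℕ i) ⊎ suc (toℕ j) ≡ toℕ i
  adjacent {i} {j} σi≡j with <-cmp (toℕ i) (toℕ j)
  ... | tri< i<j _ _ = inj₁ (adjacent-forward i<j σi≡j)
  ... | tri≈ _ i≡j _ = ⊥-elim (fixpoint-free (inj₁ i) (trans σi≡j (cong inj₁ (sym (toℕ-injective i≡j)))))
  ... | tri> _ _ j<i = inj₂ (sym (adjacent-forward j<i (partner-sym σi≡j)))

between-neighbours : ∀ a k → k ≢ a → k ≢ suc a → between a (suc a) k ≡ false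
between-neighbours a k k≢a k≢a+1 = ¬T⇒≡false (excluded ∘ Equivalence.to T-∨)
  where
  excluded : T ((a ≤ᵇ k) ∧ (k ≤ᵇ suc a)) ⊎ T ((suc a ≤ᵇ k) ∧ (k ≤ᵇ a)) → ⊥
  excluded (inj₁ t) with Equivalence.to T-∧ t
  ... | a≤k , k≤a+1 = k≢a+1 (≤-antisym (≤ᵇ⇒≤ k (suc a) k≤a+1) (≤∧≢⇒< (≤ᵇ⇒≤ a k a≤k) (k≢a ∘ sym)))
  excluded (inj₂ t) with Equivalence.to T-∧ t
  ... | a+1≤k , k≤a = <-irrefl refl (≤-trans (≤ᵇ⇒≤ (suc a) k a+1≤k) (≤ᵇ⇒≤ k a k≤a))

between-comm : ∀ a b k → between a b k ≡ between b a k
between-comm a b k = ∨-comm ((a ≤ᵇ k) ∧ (k ≤ᵇ b)) _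

isPoint₁ : ∀ {p q} → Pos p q → Fin p → Bool
isPoint₁ (inj₁ j) i = eqFin j i
isPoint₁ (inj₂ _) _ = false

isPoint₁⇒≡ : ∀ {p q} {u : Pos p q} {i} → isPoint₁ u i ≡ true → u ≡ inj₁ i
isPoint₁⇒≡ {u = inj₁ j} e = cong inj₁ (eqFin⇒≡ e)

isLine₂ : ∀ {p q} → Pos p q → Bool
isLine₂ (inj₁ _) = false
isLine₂ (inj₂ _) = true

lineConfig : ∀ {k q} → (Pos (suc k) q → Pos (suc k) q) → Vec Bool k
lineConfig σ = tabulate (λ j → isPoint₁ (σ (inj₁ (inject₁ j))) (suc j))

lineConfig-cong : ∀ {k q} (σ τ : Pos (suc k) q → Pos (suc k) q) →
                  (∀ i → σ (inj₁ i) ≡ τ (inj₁ i)) → lineConfig σ ≡ lineConfig τ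
lineConfig-cong σ τ σ≗τ = tabulate-cong (λ j → cong (λ u → isPoint₁ u (suc j)) (σ≗τ (inject₁ j)))

module _ {k q : ℕ} (σ : Pos (suc k) q → Pos (suc k) q) where

  config-right⇒ : ∀ {i} → rightSeg (lineConfig σ) i ≡ true → ∃[ j ] σ (inj₁ i) ≡ inj₁ j × toℕ j ≡ suc (toℕ i)
  config-right⇒ {i} r with rightSeg⇒inject₁ (lineConfig σ) i r
  ... | j , refl = suc j , σi≡j+1 , cong suc (sym (toℕ-inject₁ j))
    where
    entry : isPoint₁ (σ (inj₁ (inject₁ j))) (suc j) ≡ true
    entry = trans (sym (lookup∘tabulate _ j)) (trans (sym (rightSeg-inject₁ (lineConfig σ) j)) r)
    σi≡j+1 : σ (inj₁ (inject₁ j)) ≡ inj₁ (suc j)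
    σi≡j+1 = isPoint₁⇒≡ entry

  ⇒config-right : ∀ {i j} → σ (inj₁ i) ≡ inj₁ j → toℕ j ≡ suc (toℕ i) → rightSeg (lineConfig σ) i ≡ true
  ⇒config-right {i} {suc j} σi≡j j≡i+1 = begin
    rightSeg (lineConfig σ) i             ≡⟨ cong (rightSeg (lineConfig σ)) i≡j ⟩
    rightSeg (lineConfig σ) (inject₁ j)   ≡⟨ rightSeg-inject₁ (lineConfig σ) j ⟩
    lookup (lineConfig σ) j               ≡⟨ lookup∘tabulate _ j ⟩
    isPoint₁ (σ (inj₁ (inject₁ j))) (suc j)  ≡⟨ cong (λ v → isPoint₁ (σ (inj₁ v)) (suc j)) (sym i≡j) ⟩
    isPoint₁ (σ (inj₁ i)) (suc j)         ≡⟨ cong (λ v → isPoint₁ v (suc j)) σi≡j ⟩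
    eqFin (suc j) (suc j)                 ≡⟨ eqFin-refl (suc j) ⟩
    true                                  ∎
    where
    open ≡-Reasoning
    i≡j : i ≡ inject₁ j
    i≡j = toℕ-injective (trans (suc-injective (sym j≡i+1)) (sym (toℕ-inject₁ j)))

  config-left⇒ : ∀ {i} → leftSeg (lineConfig σ) i ≡ true → ∃[ j ] σ (inj₁ j) ≡ inj₁ i × toℕ i ≡ suc (toℕ j)
  config-left⇒ {suc i} l with config-right⇒ {inject₁ i} (trans (sym (leftSeg-suc (lineConfig σ) i)) l)
  ... | j , σi≡j , j≡i+1 = inject₁ i , subst (λ v → σ (inj₁ (inject₁ i)) ≡ inj₁ v) j≡suc σi≡j , cong suc (sym (toℕ-inject₁ i))
    where
    j≡suc : j ≡ suc i
    j≡suc = toℕ-injective (trans j≡i+1 (cong suc (toℕ-inject₁ i)))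

  ⇒config-left : ∀ {i j} → σ (inj₁ j) ≡ inj₁ i → toℕ i ≡ suc (toℕ j) → leftSeg (lineConfig σ) i ≡ true
  ⇒config-left σj≡i i≡j+1 = trans (leftSeg-next (lineConfig σ) i≡j+1) (⇒config-right σj≡i i≡j+1)

data Paired {k q : ℕ} (c : Vec Bool k) (i : Fin (suc k)) : Pos (suc k) q → Set where
  to-right : ∀ {j} → toℕ j ≡ suc (toℕ i) → rightSeg c i ≡ true  → leftSeg c i ≡ false → Paired c i (inj₁ j)
  to-left  : ∀ {j} → suc (toℕ j) ≡ toℕ i → rightSeg c i ≡ false → leftSeg c i ≡ true  → Paired c i (inj₁ j)
  across   : ∀ {j} → rightSeg c i ≡ false → leftSeg c i ≡ false → Paired c i (inj₂ j)

module _ {k q : ℕ} {c : Vec Bool k} where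

  private
    same : ∀ {x y : Fin (suc k)} → toℕ x ≡ toℕ y → _≡_ {A = Pos (suc k) q} (inj₁ x) (inj₁ y)
    same = cong inj₁ ∘ toℕ-injective

  paired-unique₁ : ∀ {i j} {v : Pos (suc k) q} → Paired {q = q} c i (inj₁ j) → Paired c i v → v ≡ inj₁ j
  paired-unique₁ (to-right j≡ _ _) (to-right j′≡ _ _) = cong inj₁ (toℕ-injective (trans j′≡ (sym j≡)))
  paired-unique₁ (to-right _ r _)  (to-left _ ¬r _)   = ⊥-elim (true≢false (trans (sym r) ¬r))
  paired-unique₁ (to-right _ r _)  (across ¬r _)      = ⊥-elim (true≢false (trans (sym r) ¬r))
  paired-unique₁ (to-left _ ¬r _)  (to-right _ r _)   = ⊥-elim (true≢false (trans (sym r) ¬r))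
  paired-unique₁ (to-left j≡ _ _)  (to-left j′≡ _ _)  = cong inj₁ (toℕ-injective (suc-injective (trans j′≡ (sym j≡))))
  paired-unique₁ (to-left _ _ l)   (across _ ¬l)      = ⊥-elim (true≢false (trans (sym l) ¬l))

  paired-free : ∀ {i} {u : Pos (suc k) q} → Paired c i u → isFree c i ≡ isLine₂ u
  paired-free (to-right _ r _) rewrite r = refl
  paired-free (to-left _ r l)  rewrite r | l = refl
  paired-free (across r l)     rewrite r | l = refl

  paired-single : ∀ {i} {u : Pos (suc k) q} → Paired c i u → leftSeg c i ∧ rightSeg c i ≡ false
  paired-single (to-right _ _ l) rewrite l = refl
  paired-single (to-left _ r l)  rewrite l | r = refl
  paired-single (across _ l)     rewrite l = refl

  lineConfig-paired : (σ : Pos (suc k) q → Pos (suc k) q) → (∀ i → Paired c i (σ (inj₁ i))) → lineConfig σ ≡ c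
  lineConfig-paired σ paired = begin
    tabulate (λ j → isPoint₁ (σ (inj₁ (inject₁ j))) (suc j))  ≡⟨ tabulate-cong (λ j → entry j (paired (inject₁ j))) ⟩
    tabulate (lookup c)                                       ≡⟨ tabulate∘lookup c ⟩
    c                                                         ∎
    where
    open ≡-Reasoning
    entry : ∀ j {u} → Paired c (inject₁ j) u → isPoint₁ u (suc j) ≡ lookup c j
    entry j (to-right j′≡ r _) =
      trans (≡⇒eqFin (toℕ-injective (trans j′≡ (cong suc (toℕ-inject₁ j))))) (trans (sym r) (rightSeg-inject₁ c j))
    entry j (to-left j′≡ ¬r _) =
      trans (≢⇒eqFin-false (λ j′≡j+1 → n≢2+n (toℕ j) (trans (sym (toℕ-inject₁ j)) (trans (sym j′≡) (cong (suc ∘ toℕ) j′≡j+1)))))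
            (trans (sym ¬r) (rightSeg-inject₁ c j))
    entry j (across ¬r _) = trans (sym ¬r) (rightSeg-inject₁ c j)

  paired-flip : noTwoAdjacent (toList c) ≡ true → ∀ {i j} → Paired {q = q} c i (inj₁ j) → Paired {q = q} c j (inj₁ i)
  paired-flip ok (to-right j≡i+1 r _) = to-left (sym j≡i+1) (left⇒not-right c ok l) l
    where l = trans (leftSeg-next c j≡i+1) r
  paired-flip ok (to-left j+1≡i _ l) = to-right (sym j+1≡i) r (right⇒not-left c ok r)
    where r = trans (sym (leftSeg-next c (sym j+1≡i))) l

  paired-no-fixpoint : ∀ {i} {u : Pos (suc k) q} → Paired c i u → u ≢ inj₁ i
  paired-no-fixpoint {i} (to-right i≡i+1 _ _) refl = 1+n≢n (sym i≡i+1)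
  paired-no-fixpoint {i} (to-left i+1≡i _ _)  refl = 1+n≢n i+1≡i

  paired-clear : ∀ {i} {u : Pos (suc k) q} → Paired c i u → ∀ w → w ≢ inj₁ i → w ≢ u → onSeg (inj₁ i) u w ≡ false
  paired-clear {i} (to-right {j} j≡i+1 _ _) (inj₁ m) m≢i m≢j =
    subst (λ x → between (toℕ i) x (toℕ m) ≡ false) (sym j≡i+1)
      (between-neighbours (toℕ i) (toℕ m) (m≢i ∘ same) (λ e → m≢j (same (trans e (sym j≡i+1)))))
  paired-clear {i} (to-left {j} j+1≡i _ _) (inj₁ m) m≢i m≢j =
    trans (between-comm (toℕ i) (toℕ j) (toℕ m)) (subst (λ x → between (toℕ j) x (toℕ m) ≡ false) j+1≡i
      (between-neighbours (toℕ j) (toℕ m) (m≢j ∘ same) (λ e → m≢i (same (trans e j+1≡i)))))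
  paired-clear (to-right _ _ _) (inj₂ _) _ _ = refl
  paired-clear (to-left _ _ _)  (inj₂ _) _ _ = refl
  paired-clear (across _ _)     _        _ _ = refl

module _ {k q : ℕ} {σ : Pos (suc k) q → Pos (suc k) q} (V : IsNoncrossingPairing σ) where
  open IsNoncrossingPairing V

  private
    c = lineConfig σ

    partner-of-right : ∀ {i u} → rightSeg c i ≡ true → σ (inj₁ i) ≡ u → ∃[ j ] u ≡ inj₁ j × toℕ j ≡ suc (toℕ i)
    partner-of-right r σi≡u with config-right⇒ σ r
    ... | j , σi≡j , j≡i+1 = j , trans (sym σi≡u) σi≡j , j≡i+1

    partner-of-left : ∀ {i u} → leftSeg c i ≡ true → σ (inj₁ i) ≡ u → ∃[ j ] u ≡ inj₁ j × toℕ i ≡ suc (toℕ j)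
    partner-of-left l σi≡u with config-left⇒ σ l
    ... | j , σj≡i , i≡j+1 = j , trans (sym σi≡u) (partner-sym σj≡i) , i≡j+1

  classify : ∀ i → Paired c i (σ (inj₁ i))
  classify i with σ (inj₁ i) in σi≡
  ... | inj₂ j = across (¬-not right) (¬-not left)
    where
    right : rightSeg c i ≢ true
    right r with partner-of-right r σi≡
    ... | _ , () , _
    left : leftSeg c i ≢ true
    left l with partner-of-left l σi≡
    ... | _ , () , _
  ... | inj₁ j with adjacent V σi≡
  ...   | inj₁ j≡i+1 = to-right j≡i+1 (⇒config-right σ σi≡ j≡i+1) (¬-not left)
    where
    left : leftSeg c i ≢ true
    left l with partner-of-left l σi≡
    ... | _ , refl , i≡j+1 = n≢2+n (toℕ i) (trans i≡j+1 (cong suc j≡i+1))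
  ...   | inj₂ j+1≡i = to-left j+1≡i (¬-not right) (⇒config-left σ (partner-sym σi≡) (sym j+1≡i))
    where
    right : rightSeg c i ≢ true
    right r with partner-of-right r σi≡
    ... | _ , refl , j≡i+1 = n≢2+n (toℕ i) (trans (sym j+1≡i) (cong suc j≡i+1))

countBelow : ∀ {m} → (Fin m → Bool) → ℕ → ℕ
countBelow {m} P b = length (filterᵇ (λ i → P i ∧ (toℕ i <ᵇ b)) (allFin m))

countBelow-cong : ∀ {m} {P Q : Fin m → Bool} → (∀ i → P i ≡ Q i) → ∀ b → countBelow P b ≡ countBelow Q b
countBelow-cong {m} P≗Q b = cong length (filterᵇ-cong (λ i → cong (_∧ (toℕ i <ᵇ b)) (P≗Q i)) (allFin m))

rank-countBelow : ∀ {m} (P : Fin m → Bool) x → rankIn (filterᵇ P (allFin m)) x ≡ countBelow P (toℕ x)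
rank-countBelow {m} P x = cong length (filterᵇ-filterᵇ P (λ y → toℕ y <ᵇ toℕ x) (allFin m))

length-countBelow : ∀ {m} (P : Fin m → Bool) → length (filterᵇ P (allFin m)) ≡ countBelow P m
length-countBelow {m} P = cong length (filterᵇ-cong (λ i → sym (trans (cong (P i ∧_) (<ᵇ-true (toℕ<n i))) (∧-identityʳ (P i)))) (allFin m))

crossersBelow : ∀ {n} → (Pos n n → Pos n n) → ℕ → ℕ
crossersBelow σ = countBelow (λ i → isLine₂ (σ (inj₁ i)))

isLine₂⇒≡ : ∀ {n} {u : Pos n n} → isLine₂ u ≡ true → u ≡ inj₂ (reduce u)
isLine₂⇒≡ {u = inj₂ _} _ = refl

-- Partners map the crossers of the first line injectively to crossers of the second
-- line; by the noncrossing condition, those below the point i land below the partner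
-- of i.  Applied also to the mirror image, this shows that crossers are equinumerous
-- on the two lines, and that so are those below two paired points.
module _ {n : ℕ} where

  private
    crossers-≤ : ∀ {σ : Pos n n → Pos n n} → IsNoncrossingPairing σ → ∀ b₁ b₂ →
      (∀ {i j} → σ (inj₁ i) ≡ inj₂ j → toℕ i < b₁ → toℕ j < b₂) →
      crossersBelow σ b₁ ≤ crossersBelow (mirror σ) b₂
    crossers-≤ {σ} V b₁ b₂ below = count-≤ _ _ (reduce ∘ σ ∘ inj₁) (UniqueP.allFin⁺ n) maps-to injective
      where
      open IsNoncrossingPairing V
      maps-to : ∀ {i} → i ∈ allFin n → isLine₂ (σ (inj₁ i)) ∧ (toℕ i <ᵇ b₁) ≡ true →
        reduce (σ (inj₁ i)) ∈ allFin n ×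
        isLine₂ (mirror σ (inj₁ (reduce (σ (inj₁ i))))) ∧ (toℕ (reduce (σ (inj₁ i))) <ᵇ b₂) ≡ true
      maps-to {i} _ crosses = ∈P.∈-allFin _ , ∧-intro (cong (isLine₂ ∘ swap) (partner-sym σi≡j)) (<ᵇ-true (below σi≡j i<b₁))
        where
        σi≡j = isLine₂⇒≡ (∧-conicalˡ _ _ crosses)
        i<b₁ = <ᵇ⇒< (toℕ i) b₁ (Equivalence.from T-≡ (∧-conicalʳ _ _ crosses))
      injective : ∀ {x y} → x ∈ allFin n → y ∈ allFin n →
        isLine₂ (σ (inj₁ x)) ∧ (toℕ x <ᵇ b₁) ≡ true → isLine₂ (σ (inj₁ y)) ∧ (toℕ y <ᵇ b₁) ≡ true →
        reduce (σ (inj₁ x)) ≡ reduce (σ (inj₁ y)) → x ≡ y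
      injective _ _ x-crosses y-crosses same = inj₁-injective (trans (sym (partner-sym σx≡)) (partner-sym σy≡))
        where
        σx≡ = trans (isLine₂⇒≡ (∧-conicalˡ _ _ x-crosses)) (cong inj₂ same)
        σy≡ = isLine₂⇒≡ (∧-conicalˡ _ _ y-crosses)

    mirror-mirror-crossers : ∀ (σ : Pos n n → Pos n n) b → crossersBelow (mirror (mirror σ)) b ≡ crossersBelow σ b
    mirror-mirror-crossers σ b = countBelow-cong (λ i → cong isLine₂ (mirror-involutive σ (inj₁ i))) b

    both-ways : ∀ {σ : Pos n n → Pos n n} → IsNoncrossingPairing σ → ∀ b₁ b₂ →
      crossersBelow σ b₁ ≤ crossersBelow (mirror σ) b₂ → crossersBelow (mirror σ) b₂ ≤ crossersBelow (mirror (mirror σ)) b₁ →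
      crossersBelow σ b₁ ≡ crossersBelow (mirror σ) b₂
    both-ways {σ} V b₁ b₂ ≤₁ ≤₂ = ≤-antisym ≤₁ (subst (_ ≤_) (mirror-mirror-crossers σ b₁) ≤₂)

    below-partner : ∀ {σ : Pos n n → Pos n n} → IsNoncrossingPairing σ → ∀ {i j} → σ (inj₁ i) ≡ inj₂ j →
      ∀ {i′ j′} → σ (inj₁ i′) ≡ inj₂ j′ → toℕ i′ < toℕ i → toℕ j′ < toℕ j
    below-partner {σ} V {i} {j} σi≡j {i′} {j′} σi′≡j′ i′<i with <-cmp (toℕ j′) (toℕ j)
    ... | tri< j′<j _ _ = j′<j
    ... | tri≈ _ j′≡j _ = ⊥-elim (<-irrefl (cong toℕ same-point) i′<i)
      where
      open IsNoncrossingPairing V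
      same-point : i′ ≡ i
      same-point = inj₁-injective (trans (sym (partner-sym σi′≡j′)) (trans (cong (σ ∘ inj₂) (toℕ-injective j′≡j)) (partner-sym σi≡j)))
    ... | tri> _ _ j<j′ = ⊥-elim (true≢false (trans (sym crossing) uncrossed))
      where
      open IsNoncrossingPairing V
      uncrossed : crossPairs (just (toℕ i′ , toℕ j′)) (just (toℕ i , toℕ j)) ≡ false
      uncrossed = subst₂ (λ u v → crossPairs (asCross (inj₁ i′) u) (asCross (inj₁ i) v) ≡ false)
                         σi′≡j′ σi≡j (noncrossing (inj₁ i′) (inj₁ i))
      crossing : crossPairs (just (toℕ i′ , toℕ j′)) (just (toℕ i , toℕ j)) ≡ true
      crossing rewrite <ᵇ-true i′<i | <ᵇ-true j<j′ = refl

  crossers-total : ∀ {σ : Pos n n → Pos n n} → IsNoncrossingPairing σ → crossersBelow σ n ≡ crossersBelow (mirror σ) n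
  crossers-total V = both-ways V n n (crossers-≤ V n n (λ {_} {j} _ _ → toℕ<n j))
                                 (crossers-≤ (mirror-noncrossing V) n n (λ {_} {j} _ _ → toℕ<n j))

  crossers-rank : ∀ {σ : Pos n n → Pos n n} → IsNoncrossingPairing σ → ∀ {i j} → σ (inj₁ i) ≡ inj₂ j →
                  crossersBelow σ (toℕ i) ≡ crossersBelow (mirror σ) (toℕ j)
  crossers-rank {σ} V {i} {j} σi≡j = both-ways V (toℕ i) (toℕ j) (crossers-≤ V (toℕ i) (toℕ j) (below-partner V σi≡j))
    (crossers-≤ V′ (toℕ j) (toℕ i) (below-partner V′ (cong swap (partner-sym σi≡j))))
    where
    V′ = mirror-noncrossing V
    open IsNoncrossingPairing V

module _ {k : ℕ} {σ : Pos (suc k) (suc k) → Pos (suc k) (suc k)} (V : IsNoncrossingPairing σ) where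

  private
    c = lineConfig σ
    d = lineConfig (mirror σ)

    free-crosses : ∀ i → isFree c i ≡ isLine₂ (σ (inj₁ i))
    free-crosses i = paired-free (classify V i)

    free-crosses′ : ∀ j → isFree d j ≡ isLine₂ (mirror σ (inj₁ j))
    free-crosses′ j = paired-free (classify (mirror-noncrossing V) j)

  equal-free : length (freePoints c) ≡ length (freePoints d)
  equal-free = begin
    length (freePoints c)                   ≡⟨ length-countBelow (isFree c) ⟩
    countBelow (isFree c) (suc k)           ≡⟨ countBelow-cong free-crosses (suc k) ⟩
    crossersBelow σ (suc k)                 ≡⟨ crossers-total V ⟩
    crossersBelow (mirror σ) (suc k)        ≡⟨ countBelow-cong free-crosses′ (suc k) ⟨
    countBelow (isFree d) (suc k)           ≡⟨ length-countBelow (isFree d) ⟨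
    length (freePoints d)                   ∎
    where open ≡-Reasoning

  equal-rank : ∀ {i j} → σ (inj₁ i) ≡ inj₂ j → rankIn (freePoints c) i ≡ rankIn (freePoints d) j
  equal-rank {i} {j} σi≡j = begin
    rankIn (freePoints c) i                 ≡⟨ rank-countBelow (isFree c) i ⟩
    countBelow (isFree c) (toℕ i)           ≡⟨ countBelow-cong free-crosses (toℕ i) ⟩
    crossersBelow σ (toℕ i)                 ≡⟨ crossers-rank V σi≡j ⟩
    crossersBelow (mirror σ) (toℕ j)        ≡⟨ countBelow-cong free-crosses′ (toℕ j) ⟨
    countBelow (isFree d) (toℕ j)           ≡⟨ rank-countBelow (isFree d) j ⟨
    rankIn (freePoints d) j                 ∎
    where open ≡-Reasoning

  partner-free : ∀ {i j} → σ (inj₁ i) ≡ inj₂ j → isFree d j ≡ true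
  partner-free σi≡j = trans (free-crosses′ _) (cong (isLine₂ ∘ swap) (partner-sym σi≡j))
    where open IsNoncrossingPairing V

-- The inverse construction: from configurations c and d on the two lines build the
-- pairing that joins the endpoints of every chosen segment and the r-th free point of
-- the first line to the r-th free point of the second.
module Assembly {k : ℕ} where
  open Ranks (zero {k})

  matchOf : Vec Bool k → Vec Bool k → Fin (suc k) → Fin (suc k)
  matchOf c d i = nth zero (freePoints d) (rankIn (freePoints c) i)

  partnerIn : Vec Bool k → Vec Bool k → Fin (suc k) → Pos (suc k) (suc k)
  partnerIn c d i =
    if rightSeg c i then inj₁ (next i)
    else if leftSeg c i then inj₁ (pred i)
    else inj₂ (matchOf c d i)

  assemble : Vec Bool k → Vec Bool k → Pos (suc k) (suc k) → Pos (suc k) (suc k)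
  assemble c d (inj₁ i) = partnerIn c d i
  assemble c d (inj₂ j) = swap (partnerIn d c j)

  assemble-swap : ∀ c d u → assemble c d (swap u) ≡ swap (assemble d c u)
  assemble-swap c d (inj₁ i) = refl
  assemble-swap c d (inj₂ j) = sym (swap-involutive _)

  partnerIn-paired : ∀ c d → noTwoAdjacent (toList c) ≡ true → ∀ i → Paired c i (partnerIn c d i)
  partnerIn-paired c d ok i with rightSeg c i in r
  ... | true with rightSeg⇒inject₁ c i r
  ...   | j , refl = to-right (trans (cong toℕ (next-inject₁ j)) (cong suc (sym (toℕ-inject₁ j)))) r (right⇒not-left c ok r)
  partnerIn-paired c d ok i | false with leftSeg c i in l
  partnerIn-paired c d ok (suc i) | false | true = to-left (cong suc (toℕ-inject₁ i)) r l
  ... | false = across r l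

  free⇒partnerIn : ∀ c d {i} → isFree c i ≡ true → partnerIn c d i ≡ inj₂ (matchOf c d i)
  free⇒partnerIn c d {i} free
    rewrite not≡true⇒≡false (∧-conicalˡ (not (rightSeg c i)) (not (leftSeg c i)) free)
          | not≡true⇒≡false (∧-conicalʳ (not (rightSeg c i)) (not (leftSeg c i)) free) = refl

  -- The pairs of configurations counted by b (for equal lines).
  record Compatible (c d : Vec Bool k) : Set where
    field
      c-ok      : noTwoAdjacent (toList c) ≡ true
      d-ok      : noTwoAdjacent (toList d) ≡ true
      same-free : length (freePoints c) ≡ length (freePoints d)

  compatible-sym : ∀ {c d} → Compatible c d → Compatible d c
  compatible-sym H = record { c-ok = d-ok ; d-ok = c-ok ; same-free = sym same-free }
    where open Compatible H

  rankSegment : Vec Bool k → Vec Bool k → ℕ → Maybe (ℕ × ℕ)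
  rankSegment c d r = just (toℕ (nth zero (freePoints c) r) , toℕ (nth zero (freePoints d) r))

  RankMatched : Vec Bool k → Vec Bool k → Maybe (ℕ × ℕ) → Set
  RankMatched c d x = x ≡ nothing ⊎ ∃[ r ] r < length (freePoints c) × x ≡ rankSegment c d r

  module _ {c d : Vec Bool k} (H : Compatible c d) where
    open Compatible H

    private
      free∈ : ∀ {i} → isFree c i ≡ true → i ∈ freePoints c
      free∈ free = ∈-filterᵇ⁺ (isFree c) (∈P.∈-allFin _) free

      rank<free-d : ∀ {i} → isFree c i ≡ true → rankIn (freePoints c) i < length (freePoints d)
      rank<free-d free = subst (_ <_) same-free (rank<length (free∈ free))

    match-free : ∀ {i} → isFree c i ≡ true → isFree d (matchOf c d i) ≡ true
    match-free free = proj₂ (∈-filterᵇ⁻ (isFree d) (nth-∈ (freePoints d) _ (rank<free-d free)))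

    match-back : ∀ {i} → isFree c i ≡ true → matchOf d c (matchOf c d i) ≡ i
    match-back {i} free = begin
      nth zero (freePoints c) (rankIn (freePoints d) (nth zero (freePoints d) r))
        ≡⟨ cong (nth zero (freePoints c)) (rank-nth r (freePoints-increasing d) (rank<free-d free)) ⟩
      nth zero (freePoints c) r
        ≡⟨ nth-rank (freePoints-increasing c) (free∈ free) ⟩
      i ∎
      where
      open ≡-Reasoning
      r = rankIn (freePoints c) i

    partner-of-partner : ∀ i → assemble c d (partnerIn c d i) ≡ inj₁ i
    partner-of-partner i = go (partnerIn c d i) refl (partnerIn-paired c d c-ok i)
      where
      go : ∀ u → partnerIn c d i ≡ u → Paired c i u → assemble c d u ≡ inj₁ i
      go (inj₁ j) _ paired = paired-unique₁ (paired-flip c-ok paired) (partnerIn-paired c d c-ok j)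
      go (inj₂ j) partner≡j paired@(across _ _) = begin
        swap (partnerIn d c j)                ≡⟨ cong (swap ∘ partnerIn d c) j≡match ⟩
        swap (partnerIn d c (matchOf c d i))  ≡⟨ cong swap (free⇒partnerIn d c (match-free free)) ⟩
        inj₁ (matchOf d c (matchOf c d i))    ≡⟨ cong inj₁ (match-back free) ⟩
        inj₁ i                                ∎
        where
        open ≡-Reasoning
        free = paired-free paired
        j≡match = inj₂-injective (trans (sym partner≡j) (free⇒partnerIn c d free))

    partner-rank-matched : ∀ i → RankMatched c d (asCross (inj₁ i) (partnerIn c d i))
    partner-rank-matched i = go (partnerIn c d i) refl (partnerIn-paired c d c-ok i)
      where
      go : ∀ u → partnerIn c d i ≡ u → Paired c i u → RankMatched c d (asCross (inj₁ i) u)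
      go (inj₁ _) _ _ = inj₁ refl
      go (inj₂ j) partner≡j paired@(across _ _) = inj₂ (r , rank<length (free∈ free) , cong₂ (λ x y → just (toℕ x , toℕ y))
        (sym (nth-rank (freePoints-increasing c) (free∈ free))) (inj₂-injective (trans (sym partner≡j) (free⇒partnerIn c d free))))
        where
        free = paired-free paired
        r = rankIn (freePoints c) i

    private
      ordered-uncrossed : ∀ {r r′} → r < r′ → r′ < length (freePoints c) →
                          crossPairs (rankSegment c d r) (rankSegment c d r′) ≡ false
      ordered-uncrossed r<r′ r′<n
        rewrite <ᵇ-true (nth-increasing (freePoints-increasing c) r<r′ r′<n)
              | <ᵇ-false (<⇒≤ (nth-increasing (freePoints-increasing d) r<r′ (subst (_ <_) same-free r′<n)))
              | <ᵇ-false (<⇒≤ (nth-increasing (freePoints-increasing c) r<r′ r′<n)) = refl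

    rank-matched-uncrossed : ∀ {x y} → RankMatched c d x → RankMatched c d y → crossPairs x y ≡ false
    rank-matched-uncrossed (inj₁ refl)             _                          = refl
    rank-matched-uncrossed (inj₂ (_ , _ , refl))   (inj₁ refl)                = refl
    rank-matched-uncrossed (inj₂ (r , r<n , refl)) (inj₂ (r′ , r′<n , refl)) with <-cmp r r′
    ... | tri< r<r′ _ _ = ordered-uncrossed r<r′ r′<n
    ... | tri≈ _ refl _ rewrite <ᵇ-false (≤-refl {toℕ (nth zero (freePoints c) r)}) = refl
    ... | tri> _ _ r′<r = trans (crossPairs-comm (rankSegment c d r) (rankSegment c d r′)) (ordered-uncrossed r′<r r<n)

  assemble-noncrossing : ∀ {c d} → Compatible c d → IsNoncrossingPairing (assemble c d)
  assemble-noncrossing {c} {d} H = record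
    { involutive    = λ { (inj₁ i) → partner-of-partner H i
                        ; (inj₂ j) → trans (assemble-swap c d (partnerIn d c j)) (cong swap (partner-of-partner H′ j)) }
    ; fixpoint-free = λ { (inj₁ i)   → paired-no-fixpoint (partnerIn-paired c d c-ok i)
                        ; (inj₂ j) e → paired-no-fixpoint (partnerIn-paired d c d-ok j) (swap-injective e) }
    ; segment-clear = λ { (inj₁ i) w → paired-clear (partnerIn-paired c d c-ok i) w
                        ; (inj₂ j) w w≢j w≢σj → begin
                            onSeg (inj₂ j) (swap (partnerIn d c j)) w
                              ≡⟨ cong (onSeg (inj₂ j) (swap (partnerIn d c j))) (swap-involutive w) ⟨
                            onSeg (swap (inj₁ j)) (swap (partnerIn d c j)) (swap (swap w))
                              ≡⟨ onSeg-swap (inj₁ j) (partnerIn d c j) (swap w) ⟩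
                            onSeg (inj₁ j) (partnerIn d c j) (swap w)
                              ≡⟨ paired-clear (partnerIn-paired d c d-ok j) (swap w) (w≢j ∘ unswap) (w≢σj ∘ unswap) ⟩
                            false ∎ }
    ; noncrossing   = λ u v → rank-matched-uncrossed H (matched u) (matched v)
    }
    where
    open Compatible H
    open ≡-Reasoning
    H′ = compatible-sym H
    unswap : ∀ {w v} → swap w ≡ v → w ≡ swap v
    unswap {w} e = trans (sym (swap-involutive w)) (cong swap e)
    matched-swap : ∀ {x} → RankMatched d c x → RankMatched c d (Maybe.map Product.swap x)
    matched-swap (inj₁ refl)             = inj₁ refl
    matched-swap (inj₂ (r , r<n , refl)) = inj₂ (r , subst (r <_) (sym same-free) r<n , refl)
    matched : ∀ u → RankMatched c d (asCross u (assemble c d u))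
    matched (inj₁ i) = partner-rank-matched H i
    matched (inj₂ j) = subst (RankMatched c d) (sym (asCross-swap (inj₁ j) (partnerIn d c j)))
                             (matched-swap (partner-rank-matched H′ j))

module _ {k : ℕ} {σ : Pos (suc k) (suc k) → Pos (suc k) (suc k)} (V : IsNoncrossingPairing σ) where
  open Assembly {k}
  open Ranks (zero {k})

  lineConfig-ok : noTwoAdjacent (toList (lineConfig σ)) ≡ true
  lineConfig-ok = ⇒noTwoAdjacent false (lineConfig σ) (λ i → paired-single (classify V i))

  configs-compatible : Compatible (lineConfig σ) (lineConfig (mirror σ))
  configs-compatible = record
    { c-ok = lineConfig-ok ; d-ok = lineConfig-ok′ ; same-free = equal-free V }
    where lineConfig-ok′ = ⇒noTwoAdjacent false _ (λ i → paired-single (classify (mirror-noncrossing V) i))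

  partnerIn-lineConfig : ∀ i → partnerIn (lineConfig σ) (lineConfig (mirror σ)) i ≡ σ (inj₁ i)
  partnerIn-lineConfig i = go (σ (inj₁ i)) refl (classify V i)
    where
    c = lineConfig σ
    d = lineConfig (mirror σ)
    go : ∀ u → σ (inj₁ i) ≡ u → Paired c i u → partnerIn c d i ≡ u
    go (inj₁ j) _ paired = paired-unique₁ paired (partnerIn-paired c d lineConfig-ok i)
    go (inj₂ j) σi≡j paired@(across _ _) = begin
      partnerIn c d i                                    ≡⟨ free⇒partnerIn c d (paired-free paired) ⟩
      inj₂ (nth zero (freePoints d) (rankIn (freePoints c) i))  ≡⟨ cong (inj₂ ∘ nth zero (freePoints d)) (equal-rank V σi≡j) ⟩
      inj₂ (nth zero (freePoints d) (rankIn (freePoints d) j))  ≡⟨ cong inj₂ (nth-rank (freePoints-increasing d) j∈) ⟩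
      inj₂ j                                             ∎
      where
      open ≡-Reasoning
      j∈ = ∈-filterᵇ⁺ (isFree d) (∈P.∈-allFin j) (partner-free V σi≡j)

module _ {k : ℕ} where
  open Assembly {k}

  assemble-lineConfig : ∀ {σ : Pos (suc k) (suc k) → Pos (suc k) (suc k)} → IsNoncrossingPairing σ →
                        ∀ u → assemble (lineConfig σ) (lineConfig (mirror σ)) u ≡ σ u
  assemble-lineConfig V (inj₁ i) = partnerIn-lineConfig V i
  assemble-lineConfig {σ} V (inj₂ j) = begin
    swap (partnerIn (lineConfig (mirror σ)) (lineConfig σ) j)
      ≡⟨ cong (λ e → swap (partnerIn (lineConfig (mirror σ)) e j))
              (lineConfig-cong (mirror (mirror σ)) σ (mirror-involutive σ ∘ inj₁)) ⟨
    swap (partnerIn (lineConfig (mirror σ)) (lineConfig (mirror (mirror σ))) j)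
      ≡⟨ cong swap (partnerIn-lineConfig (mirror-noncrossing V) j) ⟩
    swap (mirror σ (inj₁ j))
      ≡⟨ swap-involutive (σ (inj₂ j)) ⟩
    σ (inj₂ j) ∎
    where open ≡-Reasoning

  lineConfig-assemble : ∀ {c d} → Compatible c d → lineConfig (assemble c d) ≡ c × lineConfig (mirror (assemble c d)) ≡ d
  lineConfig-assemble {c} {d} H =
    lineConfig-paired (assemble c d) (partnerIn-paired c d c-ok) ,
    trans (lineConfig-cong (mirror (assemble c d)) (assemble d c)
                           (λ j → trans (cong swap (assemble-swap c d (inj₁ j))) (swap-involutive _)))
          (lineConfig-paired (assemble d c) (partnerIn-paired d c d-ok))
    where open Compatible H

module Bijection (k : ℕ) where
  open Assembly {k}

  n = suc k

  configsOf : Vec (Fin (n + n)) (n + n) → Vec Bool k × Vec Bool k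
  configsOf v = lineConfig σ , lineConfig (mirror σ)
    where σ = Encoding.decode n n v

  pairingOf : Vec Bool k × Vec Bool k → Vec (Fin (n + n)) (n + n)
  pairingOf (c , d) = Encoding.encode n n (assemble c d)

  vectors-unique : Unique (allVecs (n + n) (allFin (n + n)))
  vectors-unique = allVecs-unique (n + n) (allFin (n + n)) (UniqueP.allFin⁺ (n + n))

  pairs-unique : Unique (cartesianProduct (configs n) (configs n))
  pairs-unique = UniqueP.cartesianProduct⁺ configs-unique configs-unique
    where
    configs-unique = UniqueP.filter⁺ _ (allVecs-unique k (true ∷ false ∷ []) (((λ ()) ∷ []) ∷ [] ∷ []))

  private
    ∈-configs : ∀ {c : Vec Bool k} → noTwoAdjacent (toList c) ≡ true → c ∈ configs n
    ∈-configs ok = ∈-filterᵇ⁺ (noTwoAdjacent ∘ toList) (∈-allVecs _ (λ { {true} → here refl ; {false} → there (here refl) }) _) ok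

    configs-ok : ∀ {c : Vec Bool k} → c ∈ configs n → noTwoAdjacent (toList c) ≡ true
    configs-ok c∈ = proj₂ (∈-filterᵇ⁻ (noTwoAdjacent ∘ toList) {xs = allVecs k (true ∷ false ∷ [])} c∈)

    compatible : ∀ {c d} → (c , d) ∈ cartesianProduct (configs n) (configs n) →
                 (objects n c ≡ᵇ objects n d) ≡ true → Compatible c d
    compatible {c} {d} cd∈ same-objects = record
      { c-ok = c-ok ; d-ok = d-ok
      ; same-free = equal-objects⇒equal-free c d c-ok d-ok (≡ᵇ⇒≡′ (objects n c) (objects n d) same-objects) }
      where
      c-ok = configs-ok (proj₁ (∈P.∈-cartesianProduct⁻ (configs n) (configs n) cd∈))
      d-ok = configs-ok (proj₂ (∈P.∈-cartesianProduct⁻ (configs n) (configs n) cd∈))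

  configsOf-counted : ∀ v → validPairing n n v ≡ true →
    configsOf v ∈ cartesianProduct (configs n) (configs n) ×
    (objects n (proj₁ (configsOf v)) ≡ᵇ objects n (proj₂ (configsOf v))) ≡ true
  configsOf-counted v valid =
    ∈P.∈-cartesianProduct⁺ (∈-configs c-ok) (∈-configs d-ok) ,
    ≡⇒≡ᵇ′ (equal-free⇒equal-objects c d c-ok d-ok same-free)
    where
    σ = Encoding.decode n n v
    c = lineConfig σ
    d = lineConfig (mirror σ)
    open Compatible (configs-compatible (Encoding.validPairing⇒noncrossing n n v valid))

  pairingOf-valid : ∀ {c d} → (c , d) ∈ cartesianProduct (configs n) (configs n) →
    (objects n c ≡ᵇ objects n d) ≡ true → validPairing n n (pairingOf (c , d)) ≡ true
  pairingOf-valid cd∈ same-objects =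
    Encoding.noncrossing⇒validPairing n n _ (assemble-noncrossing (compatible cd∈ same-objects))

  pairingOf-configsOf : ∀ v → validPairing n n v ≡ true → pairingOf (configsOf v) ≡ v
  pairingOf-configsOf v valid =
    trans (Encoding.encode-cong n n (assemble-lineConfig (Encoding.validPairing⇒noncrossing n n v valid)))
          (Encoding.encode-decode n n v)

  configsOf-pairingOf : ∀ {c d} → (c , d) ∈ cartesianProduct (configs n) (configs n) →
    (objects n c ≡ᵇ objects n d) ≡ true → configsOf (pairingOf (c , d)) ≡ (c , d)
  configsOf-pairingOf {c} {d} cd∈ same-objects = cong₂ _,_
    (trans (lineConfig-cong σ (assemble c d) (decode-encode ∘ inj₁)) (proj₁ (lineConfig-assemble H)))
    (trans (lineConfig-cong (mirror σ) (mirror (assemble c d)) (cong swap ∘ decode-encode ∘ inj₂)) (proj₂ (lineConfig-assemble H)))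
    where
    H = compatible cd∈ same-objects
    σ = Encoding.decode n n (pairingOf (c , d))
    decode-encode = Encoding.decode-encode n n (assemble c d)

theorem9 : (n : ℕ) → a n n ≡ b n n
theorem9 zero    = refl
theorem9 (suc k) =
  count-≡ (validPairing (suc k) (suc k)) _ configsOf pairingOf vectors-unique pairs-unique
    (λ {v} _ valid → configsOf-counted v valid)
    (λ { {c , d} cd∈ counted → ∈-allVecs _ (∈P.∈-allFin _) _ , pairingOf-valid cd∈ counted })
    (λ {v} _ valid → pairingOf-configsOf v valid)
    (λ { {c , d} cd∈ counted → configsOf-pairingOf cd∈ counted })
  where open Bijection k
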